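{- Let $S$ be a finite generating set of the group $\mathbb{Z}$. Then there are only finitely many dead ends in $\mathbb{Z}$ with respect to $S$.
   Context: For a finite generating set $S$ of $\mathbb{Z}$, the length $\ell(n)$ of $n\in\mathbb{Z}$ is the least $k$ such that $n=s_1+\dots+s_k$ with each $s_i\in S\cup(-S)$. A dead end with respect to $S$ is an integer $d$ such that $\ell(d+s)\le\ell(d)$ for every $s\in S\cup(-S)$. -}

module Defs where

open import Data.Nat using (ℕ; _≤_)
open import Data.Integer using (ℤ; -_; _+_)
open import Data.List using (List; []; _∷_; length)
open import Data.Integer using (0ℤ)
open import Data.List.Membership.Propositional using (_∈_)
open import Data.List.Relation.Unary.All using (All)
open import Data.Product using (Σ; _×_; ∃)
open import Data.Sum using (_⊎_)
open import Relation.Binary.PropositionalEquality using (_≡_)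

sumℤ : List ℤ → ℤ
sumℤ [] = 0ℤ
sumℤ (x ∷ xs) = x + sumℤ xs

_∈±_ : ℤ → List ℤ → Set
s ∈± S = (s ∈ S) ⊎ ((- s) ∈ S)

IsWordFor : List ℤ → ℤ → List ℤ → Set
IsWordFor S n w = All (λ s → s ∈± S) w × sumℤ w ≡ n

Generates : List ℤ → Set
Generates S = ∀ (n : ℤ) → ∃ λ (w : List ℤ) → IsWordFor S n w

IsLength : List ℤ → ℤ → ℕ → Set
IsLength S n k =
  (∃ λ (w : List ℤ) → IsWordFor S n w × length w ≡ k) ×
  (∀ (w : List ℤ) → IsWordFor S n w → k ≤ length w)

DeadEnd : List ℤ → ℤ → Set
DeadEnd S d = ∀ (s : ℤ) → s ∈± S → ∀ (kd ks : ℕ) →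
  IsLength S d kd → IsLength S (d + s) ks → ks ≤ kd

-- A dead end d ≥ 0 cannot be large. Let M be the largest absolute value of a generator.
-- A shortest word for d + M cannot contain the letter M, since deleting it would give a
-- word for d shorter than ℓ(d) ≥ ℓ(d + M); so all its letters are ≤ M - 1 and
-- d + M ≤ (M - 1) ℓ(d + M). On the other hand, writing n = q M + r with r < M shows
-- ℓ(n) ≤ n / M + C for a constant C. The two bounds together force d ≤ (M - 1) M C.
-- Dead ends d < 0 are handled by the symmetry n ↦ -n of the word metric.
module Submission where

open import Defs
open import Data.Integer using (ℤ)
open import Data.List using (List)
open import Data.List.Membership.Propositional using (_∈_)
open import Data.Product using (∃)

open import Algebra.Bundles using (AbelianGroup)
open import Data.Integer as ℤ using (+_; -[1+_]; ∣_∣; -_; 0ℤ; +≤+; -≤+)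
import Data.Integer.Properties as ℤₚ
open import Data.List using ([]; _∷_; _++_; map; length; upTo)
open import Data.List.Extrema.Nat using (argmax; argmax-sel; f[xs]≤f[argmax])
open import Data.List.Membership.Propositional using (find; lose)
open import Data.List.Membership.Propositional.Properties
  using (∈-++⁺ˡ; ∈-++⁺ʳ; ∈-map⁺; ∈-upTo⁺)
open import Data.List.Properties using (length-map; length-removeAt′)
open import Data.List.Relation.Unary.All as All using (All; []; _∷_)
open import Data.List.Relation.Unary.All.Properties using (¬Any⇒All¬; ─⁺; map⁺)
open import Data.List.Relation.Unary.Any using (here; there; any?; index; _─_)
open import Data.Nat using (ℕ; zero; suc; z≤n; s≤s; _≤_; _<_; _+_; _*_; _⊔_; NonZero)
open import Data.Nat.DivMod using (_/_; _%_; m≡m%n+[m/n]*n; m%n<n)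
import Data.Nat.Properties as ℕₚ
open import Data.Product using (_×_; _,_; proj₁; proj₂)
open import Data.Sum using (inj₁; inj₂)
open import Function using (_∘_)
open import Relation.Binary.PropositionalEquality
open import Relation.Nullary using (¬_; Dec; yes; no; contradiction)
open import Relation.Nullary.Decidable using (map′)
open import Relation.Unary using (Decidable)

import Algebra.Properties.CommutativeSemigroup as CommutativeSemigroupProperties
open import Algebra.Properties.Group (AbelianGroup.group ℤₚ.+-0-abelianGroup)
  using (\\-leftDividesˡ; \\-leftDividesʳ; ∙-cancelˡ)
open CommutativeSemigroupProperties ℤₚ.+-commutativeSemigroup using (x∙yz≈y∙xz)
open CommutativeSemigroupProperties ℕₚ.*-commutativeSemigroup using (xy∙z≈xz∙y)

least : {P : ℕ → Set} → Decidable P → ∀ {n} → P n →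
        ∃ λ k → P k × (∀ {j} → P j → k ≤ j)
least P? {zero} p = zero , p , λ _ → z≤n
least {P} P? {suc n} p with P? zero
... | yes p₀ = zero , p₀ , λ _ → z≤n
... | no ¬p₀ with least (P? ∘ suc) {n} p
...   | k , pk , k-least = suc k , pk , 1+k-least
  where
  1+k-least : ∀ {j} → P j → suc k ≤ j
  1+k-least {zero} p₀ = contradiction p₀ ¬p₀
  1+k-least {suc j} pj = s≤s (k-least pj)

bounded-on-initial-segment : (f : ℕ → ℕ) (n : ℕ) → ∃ λ C → ∀ {r} → r < n → f r ≤ C
bounded-on-initial-segment f zero = 0 , λ ()
bounded-on-initial-segment f (suc n) with bounded-on-initial-segment f n
... | C , f≤C = f n ⊔ C , f≤f[n]⊔C
  where
  f≤f[n]⊔C : ∀ {r} → r < suc n → f r ≤ f n ⊔ C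
  f≤f[n]⊔C r<1+n with ℕₚ.m<1+n⇒m<n∨m≡n r<1+n
  ... | inj₁ r<n = ℕₚ.m≤n⇒m≤o⊔n (f n) (f≤C r<n)
  ... | inj₂ refl = ℕₚ.m≤m⊔n (f n) C

x≤k*m⇒k*[1+m]≤x+K⇒x≤K*m : ∀ {x k m K} → x ≤ k * m → k * suc m ≤ x + K → x ≤ K * m
x≤k*m⇒k*[1+m]≤x+K⇒x≤K*m {x} {k} {m} {K} x≤km k[1+m]≤x+K =
  ℕₚ.+-cancelˡ-≤ (x * m) x (K * m) (begin
    x * m + x         ≡⟨ ℕₚ.+-comm (x * m) x ⟩
    x + x * m         ≡⟨ ℕₚ.*-suc x m ⟨
    x * suc m         ≤⟨ ℕₚ.*-monoˡ-≤ (suc m) x≤km ⟩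
    k * m * suc m     ≡⟨ xy∙z≈xz∙y k m (suc m) ⟩
    k * suc m * m     ≤⟨ ℕₚ.*-monoˡ-≤ m k[1+m]≤x+K ⟩
    (x + K) * m       ≡⟨ ℕₚ.*-distribʳ-+ m x K ⟩
    x * m + K * m     ∎)
  where open ℕₚ.≤-Reasoning

∣i∣≤n⇒i≤+n : ∀ {i n} → ∣ i ∣ ≤ n → i ℤ.≤ + n
∣i∣≤n⇒i≤+n {+ _} ∣i∣≤n = +≤+ ∣i∣≤n
∣i∣≤n⇒i≤+n { -[1+ _ ]} _ = -≤+

∣i∣≤1+n⇒i≢1+n⇒i≤n : ∀ {i n} → ∣ i ∣ ≤ suc n → i ≢ + suc n → i ℤ.≤ + n
∣i∣≤1+n⇒i≢1+n⇒i≤n {+ _} ∣i∣≤1+n i≢1+n =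
  +≤+ (ℕₚ.m<1+n⇒m≤n (ℕₚ.≤∧≢⇒< ∣i∣≤1+n (i≢1+n ∘ cong (ℤ.+_))))
∣i∣≤1+n⇒i≢1+n⇒i≤n { -[1+ _ ]} _ _ = -≤+

nonNegativesUpTo : ℕ → List ℤ
nonNegativesUpTo n = map (ℤ.+_) (upTo (suc n))

symmetricRange : ℕ → List ℤ
symmetricRange n = nonNegativesUpTo n ++ map -_ (nonNegativesUpTo n)

k≤n⇒+k∈nonNegativesUpTo : ∀ {k n} → k ≤ n → + k ∈ nonNegativesUpTo n
k≤n⇒+k∈nonNegativesUpTo k≤n = ∈-map⁺ (ℤ.+_) (∈-upTo⁺ (s≤s k≤n))

∣i∣≤n⇒i∈symmetricRange : ∀ {i n} → ∣ i ∣ ≤ n → i ∈ symmetricRange n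
∣i∣≤n⇒i∈symmetricRange {i} {n} ∣i∣≤n with ℤₚ.+∣i∣≡i⊎+∣i∣≡-i i
... | inj₁ +∣i∣≡i =
  ∈-++⁺ˡ (subst (_∈ nonNegativesUpTo n) +∣i∣≡i (k≤n⇒+k∈nonNegativesUpTo ∣i∣≤n))
... | inj₂ +∣i∣≡-i =
  ∈-++⁺ʳ (nonNegativesUpTo n)
    (subst (_∈ map -_ (nonNegativesUpTo n)) (trans (cong -_ +∣i∣≡-i) (ℤₚ.neg-involutive i))
      (∈-map⁺ -_ (k≤n⇒+k∈nonNegativesUpTo ∣i∣≤n)))

sumℤ-map-neg : ∀ w → sumℤ (map -_ w) ≡ - sumℤ w
sumℤ-map-neg [] = refl
sumℤ-map-neg (a ∷ w) =
  trans (cong (λ x → - a ℤ.+ x) (sumℤ-map-neg w)) (sym (ℤₚ.neg-distrib-+ a (sumℤ w)))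

sumℤ-─ : ∀ {a w} (a∈w : a ∈ w) → sumℤ w ≡ a ℤ.+ sumℤ (w ─ a∈w)
sumℤ-─ (here refl) = refl
sumℤ-─ {a} {b ∷ w} (there a∈w) =
  trans (cong (λ x → b ℤ.+ x) (sumℤ-─ a∈w)) (x∙yz≈y∙xz b a _)

sumℤ-≤ : ∀ {c} w → All (ℤ._≤ + c) w → sumℤ w ℤ.≤ + (length w * c)
sumℤ-≤ [] [] = +≤+ z≤n
sumℤ-≤ (a ∷ w) (a≤c ∷ w≤c) = ℤₚ.+-mono-≤ a≤c (sumℤ-≤ w w≤c)

module _ (S : List ℤ) where

  ∈±-neg : ∀ {a} → a ∈± S → (- a) ∈± S
  ∈±-neg {a} (inj₁ a∈S) = inj₂ (subst (_∈ S) (sym (ℤₚ.neg-involutive a)) a∈S)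
  ∈±-neg (inj₂ -a∈S) = inj₁ -a∈S

  ∃∈±? : {P : ℤ → Set} → Decidable P → Dec (∃ λ a → a ∈± S × P a)
  ∃∈±? {P} P? with any? P? S | any? (P? ∘ -_) S
  ... | yes P[S] | _ with find P[S]
  ...   | a , a∈S , pa = yes (a , inj₁ a∈S , pa)
  ∃∈±? P? | no _ | yes P[-S] with find P[-S]
  ...   | a , a∈S , p[-a] = yes (- a , ∈±-neg (inj₁ a∈S) , p[-a])
  ∃∈±? {P} P? | no ¬P[S] | no ¬P[-S] = no λ where
    (a , inj₁ a∈S , pa) → ¬P[S] (lose a∈S pa)
    (a , inj₂ -a∈S , pa) → ¬P[-S] (lose -a∈S (subst P (sym (ℤₚ.neg-involutive a)) pa))

  HasWordOfLength : ℤ → ℕ → Set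
  HasWordOfLength n k = ∃ λ w → IsWordFor S n w × length w ≡ k

  hasWordOfLength? : ∀ n k → Dec (HasWordOfLength n k)
  hasWordOfLength? n zero = map′ (λ { refl → [] , ([] , refl) , refl })
                                 (λ { ([] , (_ , 0≡n) , _) → 0≡n })
                                 (0ℤ ℤ.≟ n)
  hasWordOfLength? n (suc k) =
    map′ prepend unprepend (∃∈±? (λ a → hasWordOfLength? (- a ℤ.+ n) k))
    where
    prepend : (∃ λ a → a ∈± S × HasWordOfLength (- a ℤ.+ n) k) → HasWordOfLength n (suc k)
    prepend (a , a∈± , w , (w∈± , sum≡) , len≡) =
      a ∷ w ,
      (a∈± ∷ w∈± , trans (cong (λ x → a ℤ.+ x) sum≡) (\\-leftDividesˡ a n)) ,
      cong suc len≡
    unprepend : HasWordOfLength n (suc k) → ∃ λ a → a ∈± S × HasWordOfLength (- a ℤ.+ n) k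
    unprepend (a ∷ w , (a∈± ∷ w∈± , sum≡) , len≡) =
      a , a∈± , w ,
      (w∈± , trans (sym (\\-leftDividesʳ a (sumℤ w))) (cong (λ x → - a ℤ.+ x) sum≡)) ,
      ℕₚ.suc-injective len≡

  length-exists : Generates S → ∀ n → ∃ (IsLength S n)
  length-exists generates n with generates n
  ... | w , w-word with least (hasWordOfLength? n) (w , w-word , refl)
  ...   | k , has-k , k-least = k , has-k , λ v v-word → k-least (v , v-word , refl)

  isWordFor-neg : ∀ {n w} → IsWordFor S n w → IsWordFor S (- n) (map -_ w)
  isWordFor-neg {w = w} (w∈± , sum≡n) =
    map⁺ (All.map ∈±-neg w∈±) , trans (sumℤ-map-neg w) (cong -_ sum≡n)

  isLength-neg : ∀ {n k} → IsLength S n k → IsLength S (- n) k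
  isLength-neg {n} {k} ((w , w-word , len≡) , k-least) =
    (map -_ w , isWordFor-neg w-word , trans (length-map -_ w) len≡) ,
    λ v v-word → subst (k ≤_) (length-map -_ v)
      (k-least (map -_ v)
        (subst (λ m → IsWordFor S m (map -_ v)) (ℤₚ.neg-involutive n) (isWordFor-neg v-word)))

  deadEnd-neg : ∀ {d} → DeadEnd S d → DeadEnd S (- d)
  deadEnd-neg {d} dead s s∈± kd ks ℓ[-d] ℓ[-d+s] =
    dead (- s) (∈±-neg s∈±) kd ks
      (subst (λ m → IsLength S m kd) (ℤₚ.neg-involutive d) (isLength-neg ℓ[-d]))
      (subst (λ m → IsLength S m ks) -[-d+s]≡d-s (isLength-neg ℓ[-d+s]))
    where
    -[-d+s]≡d-s : - (- d ℤ.+ s) ≡ d ℤ.+ - s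
    -[-d+s]≡d-s = trans (ℤₚ.neg-distrib-+ (- d) s) (cong (ℤ._+ - s) (ℤₚ.neg-involutive d))

  a∉short-word[n+a] : ∀ {n a w k} → IsLength S n k → IsWordFor S (n ℤ.+ a) w → length w ≤ k →
                      ¬ (a ∈ w)
  a∉short-word[n+a] {n} {a} {w} {k} (_ , k-least) (w∈± , sum≡) len≤k a∈w =
    ℕₚ.1+n≰n (begin
      suc (length (w ─ a∈w)) ≡⟨ length-removeAt′ w (index a∈w) ⟨
      length w               ≤⟨ len≤k ⟩
      k                      ≤⟨ k-least (w ─ a∈w) (─⁺ a∈w w∈± , sum[w─a]≡n) ⟩
      length (w ─ a∈w)       ∎)
    where
    open ℕₚ.≤-Reasoning
    sum[w─a]≡n : sumℤ (w ─ a∈w) ≡ n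
    sum[w─a]≡n = ∙-cancelˡ a _ n (trans (sym (sumℤ-─ a∈w)) (trans sum≡ (ℤₚ.+-comm n a)))

  longestLetter : ℤ
  longestLetter = argmax ∣_∣ 0ℤ S

  ∣letter∣≤∣longestLetter∣ : ∀ {a} → a ∈± S → ∣ a ∣ ≤ ∣ longestLetter ∣
  ∣letter∣≤∣longestLetter∣ (inj₁ a∈S) = All.lookup (f[xs]≤f[argmax] {f = ∣_∣} 0ℤ S) a∈S
  ∣letter∣≤∣longestLetter∣ {a} (inj₂ -a∈S) =
    subst (_≤ ∣ longestLetter ∣) (ℤₚ.∣-i∣≡∣i∣ a)
      (All.lookup (f[xs]≤f[argmax] {f = ∣_∣} 0ℤ S) -a∈S)

  0<∣longestLetter∣ : Generates S → 0 < ∣ longestLetter ∣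
  0<∣longestLetter∣ generates with generates (+ 1)
  ... | w , (w∈± , sum≡1) = ℕₚ.n≢0⇒n>0 λ ∣t∣≡0 → ℕₚ.1+n≰n (begin
    1                            ≤⟨ ℤₚ.drop‿+≤+ 1≤sum ⟩
    length w * ∣ longestLetter ∣ ≡⟨ cong (length w *_) ∣t∣≡0 ⟩
    length w * 0                 ≡⟨ ℕₚ.*-zeroʳ (length w) ⟩
    0                            ∎)
    where
    open ℕₚ.≤-Reasoning
    letters≤ : All (ℤ._≤ + ∣ longestLetter ∣) w
    letters≤ = All.map (∣i∣≤n⇒i≤+n ∘ ∣letter∣≤∣longestLetter∣) w∈±
    1≤sum : + 1 ℤ.≤ + (length w * ∣ longestLetter ∣)
    1≤sum = subst (ℤ._≤ + (length w * ∣ longestLetter ∣)) sum≡1 (sumℤ-≤ w letters≤)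

  +∣longestLetter∣∈± : Generates S → (+ ∣ longestLetter ∣) ∈± S
  +∣longestLetter∣∈± generates with ℤₚ.+∣i∣≡i⊎+∣i∣≡-i longestLetter | argmax-sel ∣_∣ 0ℤ S
  ... | _ | inj₁ t≡0 =
    contradiction (subst (λ t → 0 < ∣ t ∣) t≡0 (0<∣longestLetter∣ generates)) λ ()
  ... | inj₁ +∣t∣≡t | inj₂ t∈S = inj₁ (subst (_∈ S) (sym +∣t∣≡t) t∈S)
  ... | inj₂ +∣t∣≡-t | inj₂ t∈S = subst (_∈± S) (sym +∣t∣≡-t) (∈±-neg (inj₁ t∈S))

  LargestLetter : ℕ → Set
  LargestLetter M = (+ M) ∈± S × (∀ {a} → a ∈± S → ∣ a ∣ ≤ M)

  largestLetter : Generates S → ∃ λ m → LargestLetter (suc m)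
  largestLetter generates with ∣ longestLetter ∣ in ∣t∣≡ | 0<∣longestLetter∣ generates
  ... | suc m | _ = m , subst (λ M → (+ M) ∈± S) ∣t∣≡ (+∣longestLetter∣∈± generates) ,
                    λ a∈± → subst (_ ≤_) ∣t∣≡ (∣letter∣≤∣longestLetter∣ a∈±)

  top-free-word-sum≤ : ∀ {m n w} → LargestLetter (suc m) → IsWordFor S n w → ¬ (+ suc m ∈ w) →
                       n ℤ.≤ + (length w * m)
  top-free-word-sum≤ {w = w} (_ , bounded) (w∈± , sum≡n) top∉w =
    subst (ℤ._≤ _) sum≡n (sumℤ-≤ w (All.zipWith letter≤m (w∈± , ¬Any⇒All¬ w top∉w)))
    where
    letter≤m : ∀ {a} → a ∈± S × ¬ (+ _ ≡ a) → a ℤ.≤ + _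
    letter≤m (a∈± , top≢a) = ∣i∣≤1+n⇒i≢1+n⇒i≤n (bounded a∈±) (top≢a ∘ sym)

  ShortWord : ℕ → ℕ → ℕ → Set
  ShortWord M K n = ∃ λ w → IsWordFor S (+ n) w × length w * M ≤ n + K

  shortWord-cons : ∀ {M K n} → (+ M) ∈± S → ShortWord M K n → ShortWord M K (M + n)
  shortWord-cons {M} {K} {n} M∈± (w , (w∈± , sum≡n) , short) =
    + M ∷ w , (M∈± ∷ w∈± , cong (λ x → + M ℤ.+ x) sum≡n) , (begin
      M + length w * M ≤⟨ ℕₚ.+-monoʳ-≤ M short ⟩
      M + (n + K)      ≡⟨ ℕₚ.+-assoc M n K ⟨
      M + n + K        ∎)
    where open ℕₚ.≤-Reasoning

  shortWord-+q*M : ∀ {M K r} → (+ M) ∈± S → ShortWord M K r → ∀ q → ShortWord M K (q * M + r)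
  shortWord-+q*M M∈± short-r zero = short-r
  shortWord-+q*M {M} {K} {r} M∈± short-r (suc q) =
    subst (ShortWord M K) (sym (ℕₚ.+-assoc M (q * M) r))
      (shortWord-cons M∈± (shortWord-+q*M M∈± short-r q))

  shortWords : Generates S → ∀ {M} .{{_ : NonZero M}} → (+ M) ∈± S →
               ∃ λ K → ∀ n → ShortWord M K n
  shortWords generates {M} M∈± = C * M , shortWord
    where
    wordFor : ℕ → List ℤ
    wordFor r = proj₁ (generates (+ r))
    residueLengths : ∃ λ C → ∀ {r} → r < M → length (wordFor r) ≤ C
    residueLengths = bounded-on-initial-segment (length ∘ wordFor) M
    C : ℕ
    C = proj₁ residueLengths
    residue : ∀ {r} → r < M → ShortWord M (C * M) r
    residue {r} r<M =
      wordFor r , proj₂ (generates (+ r)) ,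
      ℕₚ.≤-trans (ℕₚ.*-monoˡ-≤ M (proj₂ residueLengths r<M)) (ℕₚ.m≤n+m (C * M) r)
    shortWord : ∀ n → ShortWord M (C * M) n
    shortWord n =
      subst (ShortWord M (C * M)) (trans (ℕₚ.+-comm (n / M * M) (n % M)) (sym (m≡m%n+[m/n]*n n M)))
        (shortWord-+q*M M∈± (residue (m%n<n n M)) (n / M))

  nonNegative-deadEnd≤ : ∀ {m K} → LargestLetter (suc m) → (∀ n → ShortWord (suc m) K n) →
                         Generates S → ∀ n → DeadEnd S (+ n) → n ≤ K * m
  nonNegative-deadEnd≤ {m} {K} largest@(top , _) short generates n dead
    with length-exists generates (+ n) | length-exists generates (+ n ℤ.+ + suc m)
  ... | kd , ℓ[n] | _ , ℓ[n+M]@((w , w-word , refl) , w-shortest) =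
    ℕₚ.≤-trans (ℕₚ.m≤m+n n (suc m))
      (x≤k*m⇒k*[1+m]≤x+K⇒x≤K*m {k = length w}
        (ℤₚ.drop‿+≤+ (top-free-word-sum≤ largest w-word top∉w)) length≤)
    where
    top∉w : ¬ (+ suc m ∈ w)
    top∉w = a∉short-word[n+a] ℓ[n] w-word (dead (+ suc m) top kd (length w) ℓ[n] ℓ[n+M])
    length≤ : length w * suc m ≤ n + suc m + K
    length≤ with short (n + suc m)
    ... | u , u-word , u-short = ℕₚ.≤-trans (ℕₚ.*-monoˡ-≤ (suc m) (w-shortest u u-word)) u-short

  deadEnd-bounded : Generates S → ∃ λ B → ∀ d → DeadEnd S d → ∣ d ∣ ≤ B
  deadEnd-bounded generates with largestLetter generates
  ... | m , largest@(top , _) with shortWords generates top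
  ...   | K , short = K * m , ∣deadEnd∣≤
    where
    bound : ∀ n → DeadEnd S (+ n) → n ≤ K * m
    bound = nonNegative-deadEnd≤ largest short generates
    ∣deadEnd∣≤ : ∀ d → DeadEnd S d → ∣ d ∣ ≤ K * m
    ∣deadEnd∣≤ (+ n) dead = bound n dead
    ∣deadEnd∣≤ -[1+ n ] dead = bound (suc n) (deadEnd-neg dead)

theorem3 : (S : List ℤ) → Generates S →
    ∃ λ (L : List ℤ) → ∀ (d : ℤ) → DeadEnd S d → d ∈ L
theorem3 S generates with deadEnd-bounded S generates
... | B , ∣deadEnd∣≤B =
  symmetricRange B , λ d dead → ∣i∣≤n⇒i∈symmetricRange (∣deadEnd∣≤B d dead)
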